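{- Let $G=(U\cup W,E)$ be a non-trivial circular graph and let $u\in U$. Put $U'=U\setminus\{u\}$, $S=\{x\in W: x\notin N(u)\}$ and $W'=W\setminus S$ (so $W'=N(u)$), and let $G'=(U'\cup W',E')$ be the bipartite graph in which $u'\in U'$ and $w'\in W'$ are adjacent iff $u'w'\in E$. Then $G'$ is a linear graph with parts $U'$ and $W'$.
   Context: All graphs are finite and simple. For vertices $v_1,\dots,v_k$, $CN(v_1,\dots,v_k)$ denotes the set of common neighbours and $cn(v_1,\dots,v_k)=|CN(v_1,\dots,v_k)|$. A circular graph is a finite bipartite graph $G$ with a specified bipartition $V(G)=U\cup W$ into nonempty sets ($U\cap W=\emptyset$, every edge joins $U$ to $W$) such that (i) $cn(u_i,u_j,u_k)=1$ for all distinct $u_i,u_j,u_k\in U$, and (ii) $d(w)\ge 3$ for every $w\in W$. It is trivial if $|U|=1$ or $|W|=1$, and non-trivial otherwise. A linear graph is a bipartite graph with parts $\mathcal{P}$ and $\mathcal{L}$ such that $cn(p,q)=1$ for all distinct $p,q\in\mathcal{P}$, and $\delta\ge 2$ (minimum degree at least 2). -}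

module Defs where

open import Data.Nat using (ℕ; _≤_)
open import Data.Bool using (Bool)
open import Data.Fin using (Fin)
open import Data.Fin.Subset using (Subset; _∈_; _∩_; _─_; _-_; ∣_∣; Nonempty)
open import Data.Vec using (tabulate)
open import Data.Product using (_×_)
open import Relation.Binary.PropositionalEquality using (_≡_; _≢_)

-- Vertices of the two sides are drawn from Fin m and Fin n; the parts are
-- the subsets U ⊆ Fin m and W ⊆ Fin n, and adjacency between i ∈ U and
-- w ∈ W is given by the Boolean biadjacency relation adj.  (Entries of adj
-- outside U × W are ignored: all neighbourhoods are intersected with the
-- parts.)  Since every edge joins U to W and there is one Boolean per pair,
-- the graph is simple.
record BipGraph : Set where
  field
    m n : ℕ
    U   : Subset m
    W   : Subset n
    adj : Fin m → Fin n → Bool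

module _ (G : BipGraph) where
  open BipGraph G

  NU : Fin m → Subset n
  NU i = tabulate (adj i) ∩ W

  NW : Fin n → Subset m
  NW w = tabulate (λ i → adj i w) ∩ U

  degU : Fin m → ℕ
  degU i = ∣ NU i ∣

  degW : Fin n → ℕ
  degW w = ∣ NW w ∣

  cn2 : Fin m → Fin m → ℕ
  cn2 i j = ∣ NU i ∩ NU j ∣

  cn3 : Fin m → Fin m → Fin m → ℕ
  cn3 i j k = ∣ NU i ∩ NU j ∩ NU k ∣

  IsCircular : Set
  IsCircular =
    Nonempty U × Nonempty W ×
    (∀ i j k → i ∈ U → j ∈ U → k ∈ U → i ≢ j → i ≢ k → j ≢ k → cn3 i j k ≡ 1) ×
    (∀ w → w ∈ W → 3 ≤ degW w)

  NonTrivial : Set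
  NonTrivial = ∣ U ∣ ≢ 1 × ∣ W ∣ ≢ 1

  IsLinear : Set
  IsLinear =
    (∀ p q → p ∈ U → q ∈ U → p ≢ q → cn2 p q ≡ 1) ×
    (∀ p → p ∈ U → 2 ≤ degU p) ×
    (∀ w → w ∈ W → 2 ≤ degW w)

derived : (G : BipGraph) → Fin (BipGraph.m G) → BipGraph
derived G u = record
  { m = m ; n = n
  ; U = U - u
  ; W = W ─ S
  ; adj = adj }
  where
  open BipGraph G
  S : Subset n
  S = W ─ NU G u

-- In G′ the neighbourhood of p is N(p) ∩ N(u), so cn′(p, q) = cn(p, q, u) = 1 and
-- d′(w) = d(w) − 1 ≥ 2 for w ∈ N(u).  The only non-obvious part is d′(p) = cn(p, u) ≥ 2:
-- if N(p) ∩ N(u) = {w}, then for every third vertex k the unique common neighbour of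
-- p, u, k is w, so w is adjacent to all of U.  A second vertex w₂ ∈ W has three
-- neighbours a, b, c, which then have both w and w₂ as common neighbours,
-- contradicting cn(a, b, c) = 1.  So W = {w}, and G is trivial.
module Submission where

open import Defs
open import Data.Fin using (Fin; zero; suc; _≟_)
open import Data.Fin.Subset
open import Data.Fin.Subset.Properties
open import Data.Nat using (ℕ; suc; _≤_; s≤s; z≤n; _≤?_)
open import Data.Nat.Properties using (≤-reflexive; ≤-trans; ≤-pred; n≤1+n; ≰⇒>)
open import Data.Bool using (Bool; true; _∧_)
open import Data.Bool.Properties using (∧-zeroʳ)
open import Data.Vec using (_∷_; []; tabulate; there)
open import Data.Vec.Properties using (zipWith-identityʳ; lookup∘tabulate; []=⇒lookup; lookup⇒[]=)
open import Data.Product using (∃-syntax; _×_; _,_; proj₁; proj₂)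
open import Data.Empty using (⊥-elim)
open import Relation.Nullary using (yes; no; contradiction)
open import Relation.Binary.PropositionalEquality

private
  variable
    n : ℕ
    x y : Fin n
    p q : Subset n

x∈tabulate⁻ : ∀ {f : Fin n → Bool} → x ∈ tabulate f → f x ≡ true
x∈tabulate⁻ {x = x} {f} x∈ = trans (sym (lookup∘tabulate f x)) ([]=⇒lookup x∈)

x∈tabulate⁺ : ∀ {f : Fin n → Bool} → f x ≡ true → x ∈ tabulate f
x∈tabulate⁺ {x = x} {f} fx = lookup⇒[]= x _ (trans (lookup∘tabulate f x) fx)

x∈p─q⇒x∉q : ∀ (p q : Subset n) → x ∈ p ─ q → x ∉ q
x∈p─q⇒x∉q (_ ∷ p) (_ ∷ q) (there x∈) (there x∈q) = x∈p─q⇒x∉q p q x∈ x∈q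

x∈p-y⇒x∈p : x ∈ p - y → x ∈ p
x∈p-y⇒x∈p {p = p} {y = y} = p─q⊆p p ⁅ y ⁆

x∈p-y⇒x≢y : x ∈ p - y → x ≢ y
x∈p-y⇒x≢y {p = p} {y = y} x∈ refl = x∈p─q⇒x∉q p ⁅ y ⁆ x∈ (x∈⁅x⁆ y)

p⊆q⇒q─[q─p]≡p : p ⊆ q → q ─ (q ─ p) ≡ p
p⊆q⇒q─[q─p]≡p {p = p} {q = q} p⊆q = ⊆-antisym ⊆p p⊆
  where
  ⊆p : q ─ (q ─ p) ⊆ p
  ⊆p {x} x∈ with x ∈? p
  ... | yes x∈p = x∈p
  ... | no  x∉p = ⊥-elim (x∈p─q⇒x∉q q (q ─ p) x∈
                            (x∈p∧x∉q⇒x∈p─q (p─q⊆p q (q ─ p) x∈) x∉p))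
  p⊆ : p ⊆ q ─ (q ─ p)
  p⊆ x∈p = x∈p∧x∉q⇒x∈p─q (p⊆q x∈p) (λ x∈q─p → x∈p─q⇒x∉q q p x∈q─p x∈p)

p∩q∩r⊆p∩q : ∀ (p q r : Subset n) → p ∩ q ∩ r ⊆ p ∩ q
p∩q∩r⊆p∩q p q r x∈ with x∈p∩q⁻ p (q ∩ r) x∈
... | x∈p , x∈q∩r = x∈p∩q⁺ (x∈p , p∩q⊆p q r x∈q∩r)

p∩q∩r⊆r : ∀ (p q r : Subset n) → p ∩ q ∩ r ⊆ r
p∩q∩r⊆r p q r x∈ = p∩q⊆q q r (p∩q⊆q p (q ∩ r) x∈)

[p∩r]∩[q∩r]≡p∩q∩r : ∀ (p q r : Subset n) → (p ∩ r) ∩ (q ∩ r) ≡ p ∩ q ∩ r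
[p∩r]∩[q∩r]≡p∩q∩r p q r = begin
  (p ∩ r) ∩ (q ∩ r)  ≡⟨ ∩-assoc p r (q ∩ r) ⟩
  p ∩ r ∩ (q ∩ r)    ≡⟨ cong (p ∩_) (∩-comm r (q ∩ r)) ⟩
  p ∩ (q ∩ r) ∩ r    ≡⟨ cong (p ∩_) (∩-assoc q r r) ⟩
  p ∩ q ∩ r ∩ r      ≡⟨ cong (λ s → p ∩ q ∩ s) (∩-idem r) ⟩
  p ∩ q ∩ r          ∎
  where open ≡-Reasoning

p∩[q─r]≡p∩q─r : ∀ (p q r : Subset n) → p ∩ (q ─ r) ≡ p ∩ q ─ r
p∩[q─r]≡p∩q─r []      []      []            = refl
p∩[q─r]≡p∩q─r (a ∷ p) (b ∷ q) (inside ∷ r)  = cong₂ _∷_ (∧-zeroʳ a) (p∩[q─r]≡p∩q─r p q r)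
p∩[q─r]≡p∩q─r (a ∷ p) (b ∷ q) (outside ∷ r) = cong (a ∧ b ∷_) (p∩[q─r]≡p∩q─r p q r)

-- The tail of p - zero is a zipWith with the local difference function of _─_, not
-- literally p ─ ⊥, so p─⊥≡p does not apply and zipWith-identityʳ is used instead.
∣p∣≤suc∣p-x∣ : ∀ (p : Subset n) x → ∣ p ∣ ≤ suc ∣ p - x ∣
∣p∣≤suc∣p-x∣ (inside  ∷ p) zero    = s≤s (≤-reflexive (cong ∣_∣ (sym (zipWith-identityʳ (λ _ → refl) p))))
∣p∣≤suc∣p-x∣ (outside ∷ p) zero    = ≤-trans (≤-reflexive (cong ∣_∣ (sym (zipWith-identityʳ (λ _ → refl) p)))) (n≤1+n _)
∣p∣≤suc∣p-x∣ (inside  ∷ p) (suc x) = s≤s (∣p∣≤suc∣p-x∣ p x)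
∣p∣≤suc∣p-x∣ (outside ∷ p) (suc x) = ∣p∣≤suc∣p-x∣ p x

1≤∣p∣⇒Nonempty : ∀ {n} (p : Subset n) → 1 ≤ ∣ p ∣ → Nonempty p
1≤∣p∣⇒Nonempty {n} p 1≤∣p∣ with nonempty? p
... | yes ne = ne
... | no  p-empty = contradiction (subst (1 ≤_) ∣p∣≡0 1≤∣p∣) λ ()
  where
  ∣p∣≡0 : ∣ p ∣ ≡ 0
  ∣p∣≡0 = trans (cong ∣_∣ (Empty-unique p-empty)) (∣⊥∣≡0 n)

1+k≤∣p∣⇒k≤∣p-x∣ : ∀ {k} (p : Subset n) x → suc k ≤ ∣ p ∣ → k ≤ ∣ p - x ∣
1+k≤∣p∣⇒k≤∣p-x∣ p x 1+k≤∣p∣ = ≤-pred (≤-trans 1+k≤∣p∣ (∣p∣≤suc∣p-x∣ p x))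

x∈p⇒1≤∣p∣ : x ∈ p → 1 ≤ ∣ p ∣
x∈p⇒1≤∣p∣ x∈p = ≤-trans (s≤s z≤n) (x∈p⇒∣p-x∣<∣p∣ x∈p)

x∈p∧y∈p∧x≢y⇒2≤∣p∣ : x ∈ p → y ∈ p → x ≢ y → 2 ≤ ∣ p ∣
x∈p∧y∈p∧x≢y⇒2≤∣p∣ x∈p y∈p x≢y =
  ≤-trans (s≤s (x∈p⇒1≤∣p∣ (x∈p∧x≢y⇒x∈p-y y∈p (≢-sym x≢y)))) (x∈p⇒∣p-x∣<∣p∣ x∈p)

x∈p∧p⊆⁅x⁆⇒∣p∣≡1 : x ∈ p → p ⊆ ⁅ x ⁆ → ∣ p ∣ ≡ 1
x∈p∧p⊆⁅x⁆⇒∣p∣≡1 {x = x} {p = p} x∈p p⊆⁅x⁆ = trans (cong ∣_∣ p≡⁅x⁆) (∣⁅x⁆∣≡1 x)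
  where
  p≡⁅x⁆ : p ≡ ⁅ x ⁆
  p≡⁅x⁆ = ⊆-antisym p⊆⁅x⁆ λ y∈⁅x⁆ → subst (_∈ p) (sym (x∈⁅y⁆⇒x≡y x y∈⁅x⁆)) x∈p

3≤∣p∣⇒∃≢ : 3 ≤ ∣ p ∣ → ∀ x y → ∃[ z ] (z ∈ p × z ≢ x × z ≢ y)
3≤∣p∣⇒∃≢ {p = p} 3≤∣p∣ x y
  with z , z∈p-x-y ← 1≤∣p∣⇒Nonempty (p - x - y) (1+k≤∣p∣⇒k≤∣p-x∣ (p - x) y (1+k≤∣p∣⇒k≤∣p-x∣ p x 3≤∣p∣)) =
  z , x∈p-y⇒x∈p (x∈p-y⇒x∈p z∈p-x-y) , x∈p-y⇒x≢y (x∈p-y⇒x∈p z∈p-x-y) , x∈p-y⇒x≢y z∈p-x-y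

3≤∣p∣⇒distinct-triple : 3 ≤ ∣ p ∣ →
  ∃[ a ] ∃[ b ] ∃[ c ] (a ∈ p × b ∈ p × c ∈ p × a ≢ b × a ≢ c × b ≢ c)
3≤∣p∣⇒distinct-triple {p = p} 3≤∣p∣
  with a , a∈p        ← 1≤∣p∣⇒Nonempty p (≤-trans (s≤s z≤n) 3≤∣p∣)
  with b , b∈p , b≢a , _   ← 3≤∣p∣⇒∃≢ 3≤∣p∣ a a
  with c , c∈p , c≢a , c≢b ← 3≤∣p∣⇒∃≢ 3≤∣p∣ a b =
  a , b , c , a∈p , b∈p , c∈p , ≢-sym b≢a , ≢-sym c≢a , ≢-sym c≢b

module _ (G : BipGraph) where
  open BipGraph G

  NU⊆W : ∀ i → NU G i ⊆ W
  NU⊆W i = p∩q⊆q (tabulate (adj i)) W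

  NW⊆U : ∀ w → NW G w ⊆ U
  NW⊆U w = p∩q⊆q (tabulate (λ i → adj i w)) U

  ∈NU⇒∈NW : ∀ {i w} → i ∈ U → w ∈ NU G i → i ∈ NW G w
  ∈NU⇒∈NW {i} i∈U w∈ =
    x∈p∩q⁺ (x∈tabulate⁺ (x∈tabulate⁻ (p∩q⊆p (tabulate (adj i)) W w∈)) , i∈U)

  ∈NW⇒∈NU : ∀ {i w} → w ∈ W → i ∈ NW G w → w ∈ NU G i
  ∈NW⇒∈NU {w = w} w∈W i∈ =
    x∈p∩q⁺ (x∈tabulate⁺ (x∈tabulate⁻ (p∩q⊆p (tabulate (λ i → adj i w)) U i∈)) , w∈W)

  NU-derived : ∀ u i → NU (derived G u) i ≡ NU G i ∩ NU G u
  NU-derived u i = begin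
    tabulate (adj i) ∩ (W ─ (W ─ NU G u))     ≡⟨ cong (tabulate (adj i) ∩_) (p⊆q⇒q─[q─p]≡p (NU⊆W u)) ⟩
    tabulate (adj i) ∩ (tabulate (adj u) ∩ W) ≡⟨ [p∩r]∩[q∩r]≡p∩q∩r (tabulate (adj i)) (tabulate (adj u)) W ⟨
    NU G i ∩ NU G u                           ∎
    where open ≡-Reasoning

  NW-derived : ∀ u w → NW (derived G u) w ≡ NW G w - u
  NW-derived u w = p∩[q─r]≡p∩q─r (tabulate (λ i → adj i w)) U ⁅ u ⁆

  cn2-derived : ∀ u p q → cn2 (derived G u) p q ≡ cn3 G p q u
  cn2-derived u p q = cong ∣_∣ (begin
    NU (derived G u) p ∩ NU (derived G u) q ≡⟨ cong₂ _∩_ (NU-derived u p) (NU-derived u q) ⟩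
    (NU G p ∩ NU G u) ∩ (NU G q ∩ NU G u)   ≡⟨ [p∩r]∩[q∩r]≡p∩q∩r (NU G p) (NU G q) (NU G u) ⟩
    NU G p ∩ NU G q ∩ NU G u                ∎)
    where open ≡-Reasoning

  degU-derived : ∀ u p → degU (derived G u) p ≡ cn2 G p u
  degU-derived u p = cong ∣_∣ (NU-derived u p)

  degW-derived : ∀ u w → degW (derived G u) w ≡ ∣ NW G w - u ∣
  degW-derived u w = cong ∣_∣ (NW-derived u w)

module _ {G : BipGraph} (circular : IsCircular G) where
  open BipGraph G

  private
    W-nonempty : Nonempty W
    W-nonempty = proj₁ (proj₂ circular)

    cn3≡1 : ∀ i j k → i ∈ U → j ∈ U → k ∈ U → i ≢ j → i ≢ k → j ≢ k → cn3 G i j k ≡ 1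
    cn3≡1 = proj₁ (proj₂ (proj₂ circular))

    3≤degW : ∀ w → w ∈ W → 3 ≤ degW G w
    3≤degW = proj₂ (proj₂ (proj₂ circular))

  common-neighbour : ∀ {i j k} → i ∈ U → j ∈ U → k ∈ U → i ≢ j → i ≢ k → j ≢ k →
                     Nonempty (NU G i ∩ NU G j ∩ NU G k)
  common-neighbour i∈U j∈U k∈U i≢j i≢k j≢k =
    1≤∣p∣⇒Nonempty _ (≤-reflexive (sym (cn3≡1 _ _ _ i∈U j∈U k∈U i≢j i≢k j≢k)))

  3≤∣U∣ : 3 ≤ ∣ U ∣
  3≤∣U∣ with w , w∈W ← W-nonempty = ≤-trans (3≤degW w w∈W) (p⊆q⇒∣p∣≤∣q∣ (NW⊆U G w))

  sole-common-neighbour⇒universal : ∀ {p u w} → p ∈ U → u ∈ U → p ≢ u → cn2 G p u ≤ 1 →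
                                    w ∈ NU G p ∩ NU G u → U ⊆ NW G w
  sole-common-neighbour⇒universal {p} {u} {w} p∈U u∈U p≢u cn2≤1 w∈Npu {k} k∈U
    with k ≟ p | k ≟ u
  ... | yes refl | _        = ∈NU⇒∈NW G p∈U (p∩q⊆p (NU G p) (NU G u) w∈Npu)
  ... | no _     | yes refl = ∈NU⇒∈NW G u∈U (p∩q⊆q (NU G p) (NU G u) w∈Npu)
  ... | no k≢p   | no k≢u
    with x , x∈Npuk ← common-neighbour p∈U u∈U k∈U p≢u (≢-sym k≢p) (≢-sym k≢u) =
    ∈NU⇒∈NW G k∈U (subst (_∈ NU G k) (x≡w x∈Npu) (p∩q∩r⊆r (NU G p) (NU G u) (NU G k) x∈Npuk))
    where
    x∈Npu : x ∈ NU G p ∩ NU G u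
    x∈Npu = p∩q∩r⊆p∩q (NU G p) (NU G u) (NU G k) x∈Npuk
    x≡w : x ∈ NU G p ∩ NU G u → x ≡ w
    x≡w x∈ with x ≟ w
    ... | yes x≡w = x≡w
    ... | no  x≢w = contradiction (≤-trans (x∈p∧y∈p∧x≢y⇒2≤∣p∣ x∈ w∈Npu x≢w) cn2≤1) λ { (s≤s ()) }

  universal⇒∣W∣≡1 : ∀ {w} → w ∈ W → U ⊆ NW G w → ∣ W ∣ ≡ 1
  universal⇒∣W∣≡1 {w} w∈W U⊆Nw = x∈p∧p⊆⁅x⁆⇒∣p∣≡1 w∈W W⊆⁅w⁆
    where
    W⊆⁅w⁆ : W ⊆ ⁅ w ⁆
    W⊆⁅w⁆ {y} y∈W with y ≟ w
    ... | yes refl = x∈⁅x⁆ w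
    ... | no  y≢w
      with a , b , c , a∈Ny , b∈Ny , c∈Ny , a≢b , a≢c , b≢c ← 3≤∣p∣⇒distinct-triple (3≤degW y y∈W) =
      contradiction (≤-trans (x∈p∧y∈p∧x≢y⇒2≤∣p∣ y∈Nabc w∈Nabc y≢w) (≤-reflexive cn3-abc≡1)) λ { (s≤s ()) }
      where
      a∈U : a ∈ U
      a∈U = NW⊆U G y a∈Ny
      b∈U : b ∈ U
      b∈U = NW⊆U G y b∈Ny
      c∈U : c ∈ U
      c∈U = NW⊆U G y c∈Ny
      cn3-abc≡1 : cn3 G a b c ≡ 1
      cn3-abc≡1 = cn3≡1 a b c a∈U b∈U c∈U a≢b a≢c b≢c
      common-to-abc : ∀ {x} → x ∈ W → a ∈ NW G x → b ∈ NW G x → c ∈ NW G x →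
                      x ∈ NU G a ∩ NU G b ∩ NU G c
      common-to-abc x∈W a∈ b∈ c∈ =
        x∈p∩q⁺ (∈NW⇒∈NU G x∈W a∈ , x∈p∩q⁺ (∈NW⇒∈NU G x∈W b∈ , ∈NW⇒∈NU G x∈W c∈))
      y∈Nabc : y ∈ NU G a ∩ NU G b ∩ NU G c
      y∈Nabc = common-to-abc y∈W a∈Ny b∈Ny c∈Ny
      w∈Nabc : w ∈ NU G a ∩ NU G b ∩ NU G c
      w∈Nabc = common-to-abc w∈W (U⊆Nw a∈U) (U⊆Nw b∈U) (U⊆Nw c∈U)

  2≤cn2 : ∣ W ∣ ≢ 1 → ∀ {p u} → p ∈ U → u ∈ U → p ≢ u → 2 ≤ cn2 G p u
  2≤cn2 ∣W∣≢1 {p} {u} p∈U u∈U p≢u with 2 ≤? cn2 G p u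
  ... | yes 2≤cn2 = 2≤cn2
  ... | no  2≰cn2
    with k , k∈U , k≢p , k≢u ← 3≤∣p∣⇒∃≢ 3≤∣U∣ p u
    with w , w∈Npuk ← common-neighbour p∈U u∈U k∈U p≢u (≢-sym k≢p) (≢-sym k≢u) =
    contradiction (universal⇒∣W∣≡1 (NU⊆W G p (p∩q⊆p (NU G p) (NU G u) w∈Npu)) U⊆Nw) ∣W∣≢1
    where
    w∈Npu : w ∈ NU G p ∩ NU G u
    w∈Npu = p∩q∩r⊆p∩q (NU G p) (NU G u) (NU G k) w∈Npuk
    U⊆Nw : U ⊆ NW G w
    U⊆Nw = sole-common-neighbour⇒universal p∈U u∈U p≢u (≤-pred (≰⇒> 2≰cn2)) w∈Npu

theorem2p9 : (G : BipGraph) → IsCircular G → NonTrivial G →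
    (u : Fin (BipGraph.m G)) → u ∈ BipGraph.U G → IsLinear (derived G u)
theorem2p9 G circular@(_ , _ , cn3≡1 , 3≤degW) (_ , ∣W∣≢1) u u∈U = cn2′≡1 , 2≤degU′ , 2≤degW′
  where
  open BipGraph G
  cn2′≡1 : ∀ p q → p ∈ U - u → q ∈ U - u → p ≢ q → cn2 (derived G u) p q ≡ 1
  cn2′≡1 p q p∈U′ q∈U′ p≢q = trans (cn2-derived G u p q)
    (cn3≡1 p q u (x∈p-y⇒x∈p p∈U′) (x∈p-y⇒x∈p q∈U′) u∈U
       p≢q (x∈p-y⇒x≢y p∈U′) (x∈p-y⇒x≢y q∈U′))
  2≤degU′ : ∀ p → p ∈ U - u → 2 ≤ degU (derived G u) p
  2≤degU′ p p∈U′ = subst (2 ≤_) (sym (degU-derived G u p))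
    (2≤cn2 circular ∣W∣≢1 (x∈p-y⇒x∈p p∈U′) u∈U (x∈p-y⇒x≢y p∈U′))
  2≤degW′ : ∀ w → w ∈ W ─ (W ─ NU G u) → 2 ≤ degW (derived G u) w
  2≤degW′ w w∈W′ = subst (2 ≤_) (sym (degW-derived G u w))
    (1+k≤∣p∣⇒k≤∣p-x∣ (NW G w) u (3≤degW w (p─q⊆p W _ w∈W′)))
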